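{- Let $G$ be a finite simple graph with $p\ge1$ vertices and $q$ edges, write $q=tp+t_0$ with $t$ a nonnegative integer and $0\le t_0\le p-1$, and suppose $G$ is max-$\kappa$. If $0\le t_0<\frac{p}{4}$ or $\frac{p}{2}\le t_0<\frac{3p}{4}$, then the double graph $\mathcal{D}[G]$ is max-$\kappa$.
   Context: The total graph $T_2$ is $K_2$ with a loop added at each of its two vertices. The double graph is $\mathcal{D}[G]=G\times T_2$, where $\times$ is the Kronecker product: $V(G\times H)=V(G)\times V(H)$ and $(u_1,v_1)$ is adjacent to $(u_2,v_2)$ iff $u_1$ is adjacent to $u_2$ in $G$ and $v_1$ is adjacent to $v_2$ in $H$. Thus $\mathcal{D}[G]$ has vertex set $V(G)\times\{0,1\}$ and $(u,i)$ is adjacent to $(v,j)$ iff $uv\in E(G)$. For a graph $H$ with $p(H)$ vertices and $q(H)$ edges, $H$ is called max-$\kappa$ if $\kappa(H)=\lfloor 2q(H)/p(H)\rfloor$, where $\kappa$ is vertex-connectivity. -}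

module Defs where

open import Data.Bool using (Bool; true; false; _∧_; if_then_else_)
open import Data.Nat using (ℕ; zero; suc; _+_; _*_; _≤_; _<ᵇ_; NonZero)
open import Data.Nat.DivMod using (_/_)
open import Data.Fin using (Fin; toℕ; splitAt)
open import Data.Fin.Subset using (Subset; _∈_; ∁; ∣_∣)
open import Data.List using (List; map; allFin)
open import Data.Nat.ListAction using (sum)
open import Data.Sum using (_⊎_; [_,_]′)
open import Data.Product using (Σ; ∃; _×_; _,_)
open import Function using (id)
open import Relation.Binary.PropositionalEquality using (_≡_)
open import Relation.Nullary using (¬_)

record Graph (n : ℕ) : Set where
  field
    Adj    : Fin n → Fin n → Bool
    sym    : ∀ u v → Adj u v ≡ Adj v u
    irrefl : ∀ u → Adj u u ≡ false
open Graph public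

edgeCount : ∀ {n} → Graph n → ℕ
edgeCount {n} G =
  sum (map (λ u → sum (map (λ v →
        if (toℕ u <ᵇ toℕ v) ∧ Adj G u v then 1 else 0) (allFin n))) (allFin n))

data Reach {n} (G : Graph n) (S : Subset n) : Fin n → Fin n → Set where
  here : ∀ {u} → u ∈ S → Reach G S u u
  step : ∀ {u v w} → Reach G S u v → Adj G v w ≡ true → w ∈ S → Reach G S u w

Disconnected : ∀ {n} → Graph n → Subset n → Set
Disconnected G S = Σ _ λ u → Σ _ λ v → u ∈ S × v ∈ S × ¬ Reach G S u v

Separating : ∀ {n} → Graph n → Subset n → Set
Separating G X = Disconnected G (∁ X) ⊎ ∣ ∁ X ∣ ≤ 1

IsConnectivity : ∀ {n} → Graph n → ℕ → Set
IsConnectivity G k =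
  (Σ _ λ X → Separating G X × ∣ X ∣ ≡ k) × (∀ X → Separating G X → k ≤ ∣ X ∣)

MaxConn : ∀ {n} → .{{NonZero n}} → Graph n → Set
MaxConn {n} G = IsConnectivity G ((2 * edgeCount G) / n)

-- the double graph D[G] = G × T₂ on V(G) × {0,1}, encoded as Fin (n + n)
-- (Fin (n + n) ≅ Fin n ⊎ Fin n ≅ Fin n × Fin 2 via splitAt);
-- (u,i) ~ (v,j) iff u ~ v in G
base : ∀ {n} → Fin (n + n) → Fin n
base {n} x = [ id , id ]′ (splitAt n x)

Double : ∀ {n} → Graph n → Graph (n + n)
Double G = record
  { Adj    = λ x y → Adj G (base x) (base y)
  ; sym    = λ x y → sym G (base x) (base y)
  ; irrefl = λ x → irrefl G (base x)
  }

module Submission where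

-- κ(D[G]) = 2κ(G) for every graph G. A set X separating G doubles to X × {0,1}, which separates
-- D[G]. Conversely, if Y₀ ⊎ Y₁ separates D[G] then Y₀ ∩ Y₁ separates G: walks of G avoiding
-- Y₀ ∩ Y₁ lift to walks of D[G] avoiding Y₀ ⊎ Y₁, and if two copies of one vertex u are
-- disconnected, u is isolated in G − (Y₀ ∩ Y₁). As D[G] has 2p vertices and 4q edges,
-- ⌊2q(D[G])/p(D[G])⌋ = ⌊4q/p⌋, and this is 2⌊2q/p⌋ exactly when the fractional part of 2q/p
-- is below 1/2; for q = tp + t₀ that is the case in the two given ranges of t₀.

open import Defs hiding (sym)
open import Data.Bool using (Bool; true; false; not; _∧_; if_then_else_; T)
open import Data.Nat using (ℕ; zero; suc; _+_; _*_; _<_; _≤_; _<ᵇ_; NonZero; z≤n; s≤s)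
open import Data.Nat.Properties
open import Data.Bool.Properties using (T-≡)
open import Function.Bundles using (Equivalence)
open import Relation.Binary.Definitions using (tri<; tri≈; tri>)
open import Data.Nat.DivMod
  using (_/_; _%_; /-congˡ; /-congʳ; m*n/m*o≡n/o; +-distrib-/; [m+kn]%n≡m%n; m<n⇒m%n≡m)
open import Data.Nat.Tactic.RingSolver using (solve-∀)
open import Data.Nat.ListAction as List using ()
open import Algebra.Properties.CommutativeMonoid.Sum +-0-commutativeMonoid
  using (sum; sum-syntax; sum-cong-≗; ∑-comm; ∑-distrib-+)
open import Data.Fin using (Fin; toℕ; splitAt; _↑ˡ_; _↑ʳ_) renaming (zero to fzero; suc to fsuc)
open import Data.Fin.Properties using (toℕ-injective; splitAt-↑ˡ; splitAt-↑ʳ; any?) renaming (_≟_ to _≟ᶠ_)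
open import Data.Fin.Subset using (Subset; _∈_; ∁; ∣_∣; _∩_; _⊆_; ⁅_⁆; _-_; inside; outside)
open import Data.Fin.Subset.Properties
  using (_∈?_; nonempty?; Empty-unique; ∣⊥∣≡0; ∣⁅x⁆∣≡1; x∈⁅x⁆; x∈⁅y⁆⇒x≡y; p⊆q⇒∣p∣≤∣q∣;
         x∈∁p⇒x∉p; x∉p⇒x∈∁p; x∈p∩q⁺; x∈p∩q⁻; ∣p∩q∣≤∣p∣; ∣p∩q∣≤∣q∣; x∈p∧x≢y⇒x∈p-y; x∈p⇒∣p-x∣<∣p∣)
open import Data.List using (map; allFin; tabulate)
open import Data.List.Properties using (map-tabulate)
open import Data.Vec using (_∷_; []; lookup; _++_; take; drop)
open import Data.Vec.Properties
  using (lookup-splitAt; lookup-++ˡ; lookup-++ʳ; []=⇒lookup; lookup⇒[]=; map-++; take++drop≡id)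
open import Data.Sum using (_⊎_; inj₁; inj₂; [_,_]′)
open import Data.Product using (∃; _×_; _,_; proj₁; proj₂)
open import Function using (id; _∘_)
open import Relation.Nullary using (¬_; yes; no; contradiction)
open import Relation.Nullary.Decidable using (_×-dec_; ¬?)
open import Relation.Binary.PropositionalEquality
  using (_≡_; _≢_; refl; sym; trans; cong; cong₂; subst; subst₂; module ≡-Reasoning)

private
  variable
    m n : ℕ

2*m≡m+m : ∀ m → 2 * m ≡ m + m
2*m≡m+m m = cong (m +_) (+-identityʳ m)

m≡r+kn⇒m%n≡r : ∀ {m r} k n .{{_ : NonZero n}} → r < n → m ≡ r + k * n → m % n ≡ r
m≡r+kn⇒m%n≡r {r = r} k n r<n refl = trans ([m+kn]%n≡m%n r k n) (m<n⇒m%n≡m r<n)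

2*[2*m]/[n+n]≡2*[m/n] : ∀ m n → m % suc n + m % suc n < suc n →
                        2 * (2 * m) / (suc n + suc n) ≡ 2 * (m / suc n)
2*[2*m]/[n+n]≡2*[m/n] m n small = begin
  2 * (2 * m) / (p + p) ≡⟨ /-congʳ {m = 2 * (2 * m)} (2*m≡m+m p) ⟨
  2 * (2 * m) / (2 * p) ≡⟨ m*n/m*o≡n/o 2 (2 * m) p ⟩
  2 * m / p             ≡⟨ /-congˡ (2*m≡m+m m) ⟩
  (m + m) / p           ≡⟨ +-distrib-/ m m small ⟩
  m / p + m / p         ≡⟨ 2*m≡m+m (m / p) ⟨
  2 * (m / p)           ∎
  where
  open ≡-Reasoning
  p : ℕ
  p = suc n

remainder-decomposition : ∀ p t t₀ → t₀ < p → (4 * t₀ < p ⊎ (p ≤ 2 * t₀ × 4 * t₀ < 3 * p)) →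
  ∃ λ r → ∃ λ k → 2 * (t * p + t₀) ≡ r + k * p × r + r < p
remainder-decomposition p t t₀ _ (inj₁ 4t₀<p) =
  2 * t₀ , 2 * t , 2[ab+c]≡2c+2ab t p t₀ , subst (_< p) (4a≡2a+2a t₀) 4t₀<p
  where
  2[ab+c]≡2c+2ab : ∀ a b c → 2 * (a * b + c) ≡ 2 * c + 2 * a * b
  2[ab+c]≡2c+2ab = solve-∀
  4a≡2a+2a : ∀ a → 4 * a ≡ 2 * a + 2 * a
  4a≡2a+2a = solve-∀
remainder-decomposition p t t₀ t₀<p (inj₂ (p≤2t₀ , 4t₀<3p)) =
  d , suc (2 * t) , 2[tp+t₀]≡d+[1+2t]p , d+d<p
  where
  d : ℕ
  d = proj₁ (m≤n⇒∃[o]m+o≡n p≤2t₀)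
  p+d≡2t₀ : p + d ≡ 2 * t₀
  p+d≡2t₀ = proj₂ (m≤n⇒∃[o]m+o≡n p≤2t₀)
  2[tp+t₀]≡d+[1+2t]p : 2 * (t * p + t₀) ≡ d + suc (2 * t) * p
  2[tp+t₀]≡d+[1+2t]p = begin
    2 * (t * p + t₀)    ≡⟨ 2[ab+c]≡2ab+2c t p t₀ ⟩
    2 * t * p + 2 * t₀  ≡⟨ cong (2 * t * p +_) p+d≡2t₀ ⟨
    2 * t * p + (p + d) ≡⟨ ab+[b+c]≡c+[1+a]b (2 * t) p d ⟩
    d + suc (2 * t) * p ∎
    where
    open ≡-Reasoning
    2[ab+c]≡2ab+2c : ∀ a b c → 2 * (a * b + c) ≡ 2 * a * b + 2 * c
    2[ab+c]≡2ab+2c = solve-∀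
    ab+[b+c]≡c+[1+a]b : ∀ a b c → a * b + (b + c) ≡ c + suc a * b
    ab+[b+c]≡c+[1+a]b = solve-∀
  d+d<p : d + d < p
  d+d<p = +-cancelˡ-< (p + p) (d + d) p (begin-strict
    p + p + (d + d) ≡⟨ a+a+[b+b]≡2[a+b] p d ⟩
    2 * (p + d)     ≡⟨ cong (2 *_) p+d≡2t₀ ⟩
    2 * (2 * t₀)    ≡⟨ 2[2a]≡4a t₀ ⟩
    4 * t₀          <⟨ 4t₀<3p ⟩
    3 * p           ≡⟨ 3a≡a+a+a p ⟩
    p + p + p       ∎)
    where
    open ≤-Reasoning
    a+a+[b+b]≡2[a+b] : ∀ a b → a + a + (b + b) ≡ 2 * (a + b)
    a+a+[b+b]≡2[a+b] = solve-∀
    2[2a]≡4a : ∀ a → 2 * (2 * a) ≡ 4 * a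
    2[2a]≡4a = solve-∀
    3a≡a+a+a : ∀ a → 3 * a ≡ a + a + a
    3a≡a+a+a = solve-∀

remainder-below-half : ∀ p .{{_ : NonZero p}} t t₀ → t₀ < p →
  (4 * t₀ < p ⊎ (p ≤ 2 * t₀ × 4 * t₀ < 3 * p)) →
  2 * (t * p + t₀) % p + 2 * (t * p + t₀) % p < p
remainder-below-half p t t₀ t₀<p regime with remainder-decomposition p t t₀ t₀<p regime
... | r , k , 2[tp+t₀]≡r+kp , r+r<p =
  subst (λ s → s + s < p) (sym (m≡r+kn⇒m%n≡r k p (≤-<-trans (m≤m+n r r) r+r<p) 2[tp+t₀]≡r+kp)) r+r<p

indicator : Bool → ℕ
indicator b = if b then 1 else 0

degree : Graph n → Fin n → ℕ
degree {n} G u = ∑[ v < n ] indicator (Adj G u v)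

sum-tabulate : (f : Fin n → ℕ) → List.sum (tabulate f) ≡ sum f
sum-tabulate {zero}  f = refl
sum-tabulate {suc n} f = cong (f fzero +_) (sum-tabulate (f ∘ fsuc))

sum-map-allFin : (f : Fin n → ℕ) → List.sum (map f (allFin n)) ≡ sum f
sum-map-allFin f = trans (cong List.sum (map-tabulate id f)) (sum-tabulate f)

∑-↑ : ∀ m n (f : Fin (m + n) → ℕ) → sum f ≡ ∑[ i < m ] f (i ↑ˡ n) + ∑[ j < n ] f (m ↑ʳ j)
∑-↑ zero    n f = refl
∑-↑ (suc m) n f = trans (cong (f fzero +_) (∑-↑ m n (f ∘ fsuc))) (sym (+-assoc (f fzero) _ _))

<⇒<ᵇ≡true : ∀ {i j} → i < j → (i <ᵇ j) ≡ true
<⇒<ᵇ≡true i<j = Equivalence.to T-≡ (<⇒<ᵇ i<j)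

≮⇒<ᵇ≡false : ∀ {i j} → ¬ i < j → (i <ᵇ j) ≡ false
≮⇒<ᵇ≡false {i} {j} i≮j with i <ᵇ j in eq
... | false = refl
... | true  = contradiction (<ᵇ⇒< i j (subst T (sym eq) _)) i≮j

ordered-pair : (G : Graph n) (u v : Fin n) →
  indicator ((toℕ u <ᵇ toℕ v) ∧ Adj G u v) + indicator ((toℕ v <ᵇ toℕ u) ∧ Adj G v u) ≡
  indicator (Adj G u v)
ordered-pair G u v with <-cmp (toℕ u) (toℕ v)
... | tri< u<v _ v≮u rewrite <⇒<ᵇ≡true u<v | ≮⇒<ᵇ≡false v≮u = +-identityʳ _
... | tri> u≮v _ v<u rewrite ≮⇒<ᵇ≡false u≮v | <⇒<ᵇ≡true v<u | Graph.sym G u v = refl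
... | tri≈ _ u≡v _ rewrite toℕ-injective u≡v | ≮⇒<ᵇ≡false (<-irrefl {toℕ v} refl) | irrefl G v = refl

handshake : (G : Graph n) → 2 * edgeCount G ≡ ∑[ u < n ] degree G u
handshake {n} G = begin
  2 * edgeCount G
    ≡⟨ 2*m≡m+m (edgeCount G) ⟩
  edgeCount G + edgeCount G
    ≡⟨ cong₂ _+_ edgeCount≡ (trans edgeCount≡ (∑-comm e)) ⟩
  ∑[ u < n ] ∑[ v < n ] e u v + ∑[ u < n ] ∑[ v < n ] e v u
    ≡⟨ ∑-distrib-+ (λ u → ∑[ v < n ] e u v) (λ u → ∑[ v < n ] e v u) ⟨
  ∑[ u < n ] (∑[ v < n ] e u v + ∑[ v < n ] e v u)
    ≡⟨ sum-cong-≗ (λ u → ∑-distrib-+ (e u) (λ v → e v u)) ⟨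
  ∑[ u < n ] ∑[ v < n ] (e u v + e v u)
    ≡⟨ sum-cong-≗ (λ u → sum-cong-≗ (ordered-pair G u)) ⟩
  ∑[ u < n ] degree G u
    ∎
  where
  open ≡-Reasoning
  e : Fin n → Fin n → ℕ
  e u v = indicator ((toℕ u <ᵇ toℕ v) ∧ Adj G u v)
  edgeCount≡ : edgeCount G ≡ ∑[ u < n ] ∑[ v < n ] e u v
  edgeCount≡ = trans (sum-map-allFin (λ u → List.sum (map (e u) (allFin n))))
                     (sum-cong-≗ (λ u → sum-map-allFin (e u)))

base-↑ˡ : (u : Fin n) → base (u ↑ˡ n) ≡ u
base-↑ˡ {n} u rewrite splitAt-↑ˡ n u n = refl

base-↑ʳ : (u : Fin n) → base {n} (n ↑ʳ u) ≡ u
base-↑ʳ {n} u rewrite splitAt-↑ʳ n n u = refl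

∑-base : (f : Fin n → ℕ) → ∑[ x < n + n ] f (base x) ≡ sum f + sum f
∑-base {n} f = trans (∑-↑ n n (f ∘ base))
  (cong₂ _+_ (sum-cong-≗ (cong f ∘ base-↑ˡ)) (sum-cong-≗ (cong f ∘ base-↑ʳ)))

handshake-Double : (G : Graph n) → 2 * edgeCount (Double G) ≡ 2 * (2 * (2 * edgeCount G))
handshake-Double {n} G = begin
  2 * edgeCount (Double G)
    ≡⟨ handshake (Double G) ⟩
  ∑[ x < n + n ] degree (Double G) x
    ≡⟨ sum-cong-≗ (λ x → ∑-base (indicator ∘ Adj G (base x))) ⟩
  ∑[ x < n + n ] (degree G (base x) + degree G (base x))
    ≡⟨ ∑-distrib-+ (degree G ∘ base) (degree G ∘ base) ⟩
  ∑[ x < n + n ] degree G (base x) + ∑[ x < n + n ] degree G (base x)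
    ≡⟨ cong (λ s → s + s) (∑-base (degree G)) ⟩
  (S + S) + (S + S)
    ≡⟨ cong (λ s → s + s) (2*m≡m+m S) ⟨
  2 * S + 2 * S
    ≡⟨ 2*m≡m+m (2 * S) ⟨
  2 * (2 * S)
    ≡⟨ cong (λ s → 2 * (2 * s)) (handshake G) ⟨
  2 * (2 * (2 * edgeCount G))
    ∎
  where
  open ≡-Reasoning
  S : ℕ
  S = ∑[ u < n ] degree G u

∣p++q∣≡∣p∣+∣q∣ : (p : Subset m) (q : Subset n) → ∣ p ++ q ∣ ≡ ∣ p ∣ + ∣ q ∣
∣p++q∣≡∣p∣+∣q∣ []            q = refl
∣p++q∣≡∣p∣+∣q∣ (inside  ∷ p) q = cong suc (∣p++q∣≡∣p∣+∣q∣ p q)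
∣p++q∣≡∣p∣+∣q∣ (outside ∷ p) q = ∣p++q∣≡∣p∣+∣q∣ p q

∣∁[p∩q]∣≤∣∁p∣+∣∁q∣ : (p q : Subset n) → ∣ ∁ (p ∩ q) ∣ ≤ ∣ ∁ p ∣ + ∣ ∁ q ∣
∣∁[p∩q]∣≤∣∁p∣+∣∁q∣ []            []            = z≤n
∣∁[p∩q]∣≤∣∁p∣+∣∁q∣ (inside  ∷ p) (inside  ∷ q) = ∣∁[p∩q]∣≤∣∁p∣+∣∁q∣ p q
∣∁[p∩q]∣≤∣∁p∣+∣∁q∣ (inside  ∷ p) (outside ∷ q) =
  subst (suc ∣ ∁ (p ∩ q) ∣ ≤_) (sym (+-suc ∣ ∁ p ∣ ∣ ∁ q ∣)) (s≤s (∣∁[p∩q]∣≤∣∁p∣+∣∁q∣ p q))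
∣∁[p∩q]∣≤∣∁p∣+∣∁q∣ (outside ∷ p) (inside  ∷ q) = s≤s (∣∁[p∩q]∣≤∣∁p∣+∣∁q∣ p q)
∣∁[p∩q]∣≤∣∁p∣+∣∁q∣ (outside ∷ p) (outside ∷ q) =
  s≤s (subst (∣ ∁ (p ∩ q) ∣ ≤_) (sym (+-suc ∣ ∁ p ∣ ∣ ∁ q ∣)) (m≤n⇒m≤1+n (∣∁[p∩q]∣≤∣∁p∣+∣∁q∣ p q)))

2∣p∩q∣≤∣p∣+∣q∣ : (p q : Subset n) → 2 * ∣ p ∩ q ∣ ≤ ∣ p ∣ + ∣ q ∣
2∣p∩q∣≤∣p∣+∣q∣ p q = subst (_≤ ∣ p ∣ + ∣ q ∣) (sym (2*m≡m+m ∣ p ∩ q ∣))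
  (+-mono-≤ (∣p∩q∣≤∣p∣ p q) (∣p∩q∣≤∣q∣ p q))

∣p∣≤1⇒x≡y : ∀ {p : Subset n} {x y} → ∣ p ∣ ≤ 1 → x ∈ p → y ∈ p → x ≡ y
∣p∣≤1⇒x≡y {p = p} {x} {y} ∣p∣≤1 x∈p y∈p with x ≟ᶠ y
... | yes x≡y = x≡y
... | no  x≢y = contradiction ∣p∣≤1 (<⇒≱ (begin-strict
  1          ≡⟨ ∣⁅x⁆∣≡1 y ⟨
  ∣ ⁅ y ⁆ ∣  ≤⟨ p⊆q⇒∣p∣≤∣q∣ ⁅y⁆⊆p-x ⟩
  ∣ p - x ∣  <⟨ x∈p⇒∣p-x∣<∣p∣ x∈p ⟩
  ∣ p ∣      ∎))
  where
  open ≤-Reasoning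
  ⁅y⁆⊆p-x : ⁅ y ⁆ ⊆ p - x
  ⁅y⁆⊆p-x z∈⁅y⁆ rewrite x∈⁅y⁆⇒x≡y y z∈⁅y⁆ = x∈p∧x≢y⇒x∈p-y y∈p (x≢y ∘ sym)

Reach-target : ∀ {G : Graph n} {S u v} → Reach G S u v → v ∈ S
Reach-target (here v∈S)     = v∈S
Reach-target (step _ _ v∈S) = v∈S

Reach-independent : ∀ {G : Graph n} {S u v} →
  (∀ {a b} → a ∈ S → b ∈ S → Adj G a b ≡ false) → Reach G S u v → u ≡ v
Reach-independent independent (here _) = refl
Reach-independent independent (step r adj w∈S) with Reach-independent independent r
... | refl = contradiction (trans (sym adj) (independent (Reach-target r) w∈S)) λ ()

Reach-isolated : ∀ {G : Graph n} {S u v} →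
  (∀ {w} → w ∈ S → Adj G u w ≢ true) → Reach G S u v → v ≡ u
Reach-isolated isolated (here _) = refl
Reach-isolated isolated (step r adj w∈S) with Reach-isolated isolated r
... | refl = contradiction adj (isolated w∈S)

isolated⇒Disconnected⊎trivial : ∀ {G : Graph n} {S u} → u ∈ S →
  (∀ {w} → w ∈ S → Adj G u w ≢ true) → Disconnected G S ⊎ ∣ S ∣ ≤ 1
isolated⇒Disconnected⊎trivial {S = S} {u} u∈S isolated
  with any? (λ w → (w ∈? S) ×-dec ¬? (w ≟ᶠ u))
... | yes (w , w∈S , w≢u) = inj₁ (u , w , u∈S , w∈S , w≢u ∘ Reach-isolated isolated)
... | no  ∄w              = inj₂ (subst (∣ S ∣ ≤_) (∣⁅x⁆∣≡1 u) (p⊆q⇒∣p∣≤∣q∣ S⊆⁅u⁆))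
  where
  S⊆⁅u⁆ : S ⊆ ⁅ u ⁆
  S⊆⁅u⁆ {w} w∈S with w ≟ᶠ u
  ... | yes refl = x∈⁅x⁆ u
  ... | no  w≢u  = contradiction (w , w∈S , w≢u) ∄w

-- H arises from G by blowing each vertex v up into the independent set f⁻¹(v).
module Blowup {H : Graph m} {G : Graph n} (f : Fin m → Fin n)
              (Adj-f : ∀ a b → Adj H a b ≡ Adj G (f a) (f b)) where

  fibre-independent : ∀ {a b} → f a ≡ f b → Adj H a b ≡ false
  fibre-independent {a} fa≡fb =
    trans (Adj-f a _) (trans (cong (Adj G (f a)) (sym fa≡fb)) (irrefl G (f a)))

  Reach-map : ∀ {S T a b} → (∀ {c} → c ∈ S → f c ∈ T) → Reach H S a b → Reach G T (f a) (f b)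
  Reach-map f∈ (here a∈S)      = here (f∈ a∈S)
  Reach-map f∈ (step r adj c∈S) = step (Reach-map f∈ r) (trans (sym (Adj-f _ _)) adj) (f∈ c∈S)

  module _ {S T} (lift : ∀ {u} → u ∈ T → ∃ λ a → a ∈ S × f a ≡ u) where

    step-lift : ∀ {u v w a b} → Reach G T u v → Adj G v w ≡ true →
      a ∈ S → b ∈ S → f a ≡ u → f b ≡ w → Reach H S a b
    step-lift (here _) adj a∈S b∈S refl refl = step (here a∈S) (trans (Adj-f _ _) adj) b∈S
    step-lift (step r adj′ v∈T) adj a∈S b∈S fa≡u refl with lift v∈T
    ... | c , c∈S , refl =
      step (step-lift r adj′ a∈S c∈S fa≡u refl) (trans (Adj-f _ _) adj) b∈S

    Reach-lift : ∀ {u v a b} → u ≢ v → Reach G T u v →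
      a ∈ S → b ∈ S → f a ≡ u → f b ≡ v → Reach H S a b
    Reach-lift u≢u (here _)         = contradiction refl u≢u
    Reach-lift _   (step r adj w∈T) = step-lift r adj

↑ˡ≢↑ʳ : (u v : Fin n) → u ↑ˡ n ≢ n ↑ʳ v
↑ˡ≢↑ʳ {n} u v eq with trans (sym (splitAt-↑ˡ n u n)) (trans (cong (splitAt n) eq) (splitAt-↑ʳ n n v))
... | ()

module _ {p q : Subset n} where

  ↑ˡ∈p++q⇒∈p : ∀ {u} → u ↑ˡ n ∈ p ++ q → u ∈ p
  ↑ˡ∈p++q⇒∈p {u} h = lookup⇒[]= u p (trans (sym (lookup-++ˡ p q u)) ([]=⇒lookup h))

  ↑ʳ∈p++q⇒∈q : ∀ {u} → n ↑ʳ u ∈ p ++ q → u ∈ q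
  ↑ʳ∈p++q⇒∈q {u} h = lookup⇒[]= u q (trans (sym (lookup-++ʳ p q u)) ([]=⇒lookup h))

  base∈p∩q⇒∈p++q : ∀ {x} → base x ∈ p ∩ q → x ∈ p ++ q
  base∈p∩q⇒∈p++q {x} h with x∈p∩q⁻ p q h
  ... | bx∈p , bx∈q = lookup⇒[]= x (p ++ q)
    (trans (lookup-splitAt n p q x) (both (splitAt n x) ([]=⇒lookup bx∈p) ([]=⇒lookup bx∈q)))
    where
    both : ∀ s → lookup p ([ id , id ]′ s) ≡ true → lookup q ([ id , id ]′ s) ≡ true →
           [ lookup p , lookup q ]′ s ≡ true
    both (inj₁ _) hp _  = hp
    both (inj₂ _) _  hq = hq

  base∈∁[p∩q] : ∀ {x} → x ∈ ∁ (p ++ q) → base x ∈ ∁ (p ∩ q)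
  base∈∁[p∩q] x∈ = x∉p⇒x∈∁p (x∈∁p⇒x∉p x∈ ∘ base∈p∩q⇒∈p++q)

  lift∈∁[p∩q] : ∀ {u} → u ∈ ∁ (p ∩ q) → ∃ λ x → x ∈ ∁ (p ++ q) × base x ≡ u
  lift∈∁[p∩q] {u} u∈ with u ∈? p
  ... | no  u∉p = u ↑ˡ n , x∉p⇒x∈∁p (u∉p ∘ ↑ˡ∈p++q⇒∈p) , base-↑ˡ u
  ... | yes u∈p =
    n ↑ʳ u , x∉p⇒x∈∁p (λ h → x∈∁p⇒x∉p u∈ (x∈p∩q⁺ (u∈p , ↑ʳ∈p++q⇒∈q h))) , base-↑ʳ u

module _ {X : Subset n} where

  base∈∁X : ∀ {x} → x ∈ ∁ (X ++ X) → base x ∈ ∁ X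
  base∈∁X x∈ = x∉p⇒x∈∁p (λ bx∈X → x∈∁p⇒x∉p x∈ (base∈p∩q⇒∈p++q (x∈p∩q⁺ (bx∈X , bx∈X))))

  ↑ˡ∈∁[X++X] : ∀ {u} → u ∈ ∁ X → u ↑ˡ n ∈ ∁ (X ++ X)
  ↑ˡ∈∁[X++X] u∈ = x∉p⇒x∈∁p (x∈∁p⇒x∉p u∈ ∘ ↑ˡ∈p++q⇒∈p)

  ↑ʳ∈∁[X++X] : ∀ {u} → u ∈ ∁ X → n ↑ʳ u ∈ ∁ (X ++ X)
  ↑ʳ∈∁[X++X] u∈ = x∉p⇒x∈∁p (x∈∁p⇒x∉p u∈ ∘ ↑ʳ∈p++q⇒∈q)

module _ (G : Graph n) where

  private
    D : Graph (n + n)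
    D = Double G
    open Blowup {H = D} {G = G} base (λ _ _ → refl)

  Separating-++ : ∀ {X} → Separating G X → Separating D (X ++ X)
  Separating-++ (inj₁ (u , v , u∈ , v∈ , u↛v)) =
    inj₁ (u ↑ˡ n , v ↑ˡ n , ↑ˡ∈∁[X++X] u∈ , ↑ˡ∈∁[X++X] v∈ ,
          u↛v ∘ subst₂ (Reach G _) (base-↑ˡ u) (base-↑ˡ v) ∘ Reach-map base∈∁X)
  Separating-++ {X} (inj₂ ∣∁X∣≤1) with nonempty? (∁ X)
  ... | yes (w , w∈) =
    inj₁ (w ↑ˡ n , n ↑ʳ w , ↑ˡ∈∁[X++X] w∈ , ↑ʳ∈∁[X++X] w∈ ,
          ↑ˡ≢↑ʳ w w ∘ Reach-independent independent)
    where
    -- G − X is the single vertex w, so D − (X ++ X) is its two non-adjacent copies.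
    independent : ∀ {a b} → a ∈ ∁ (X ++ X) → b ∈ ∁ (X ++ X) → Adj D a b ≡ false
    independent a∈ b∈ =
      fibre-independent (∣p∣≤1⇒x≡y ∣∁X∣≤1 (base∈∁X {X = X} a∈) (base∈∁X {X = X} b∈))
  ... | no ∁X-empty = inj₂ (subst (_≤ 1) (sym ∣∁[X++X]∣≡0) z≤n)
    where
    ∣∁[X++X]∣≡0 : ∣ ∁ (X ++ X) ∣ ≡ 0
    ∣∁[X++X]∣≡0 = trans (cong ∣_∣ (Empty-unique λ (x , x∈) → ∁X-empty (base x , base∈∁X {X = X} x∈)))
                        (∣⊥∣≡0 (n + n))

  Separating-∩ : ∀ {Y₀ Y₁} → Separating D (Y₀ ++ Y₁) → Separating G (Y₀ ∩ Y₁)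
  Separating-∩ {Y₀} {Y₁} (inj₂ ∣∁Y∣≤1) = inj₂ (begin
    ∣ ∁ (Y₀ ∩ Y₁) ∣         ≤⟨ ∣∁[p∩q]∣≤∣∁p∣+∣∁q∣ Y₀ Y₁ ⟩
    ∣ ∁ Y₀ ∣ + ∣ ∁ Y₁ ∣     ≡⟨ ∣p++q∣≡∣p∣+∣q∣ (∁ Y₀) (∁ Y₁) ⟨
    ∣ ∁ Y₀ ++ ∁ Y₁ ∣        ≡⟨ cong ∣_∣ (map-++ not Y₀ Y₁) ⟨
    ∣ ∁ (Y₀ ++ Y₁) ∣        ≤⟨ ∣∁Y∣≤1 ⟩
    1                       ∎)
    where open ≤-Reasoning
  Separating-∩ {Y₀} {Y₁} (inj₁ (x , y , x∈ , y∈ , x↛y)) with base x ≟ᶠ base y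
  ... | no bx≢by = inj₁ (base x , base y , base∈∁[p∩q] x∈ , base∈∁[p∩q] y∈ ,
                         λ r → x↛y (Reach-lift lift∈∁[p∩q] bx≢by r x∈ y∈ refl refl))
  ... | yes bx≡by = isolated⇒Disconnected⊎trivial (base∈∁[p∩q] x∈) isolated
    where
    -- a neighbour w of base x would give the path x, w, y in D
    isolated : ∀ {w} → w ∈ ∁ (Y₀ ∩ Y₁) → Adj G (base x) w ≢ true
    isolated w∈ adj = x↛y (step-lift lift∈∁[p∩q] (step (here (base∈∁[p∩q] x∈)) adj w∈)
      (trans (Graph.sym G _ _) adj) x∈ y∈ refl (sym bx≡by))

  IsConnectivity-Double : ∀ {k} → IsConnectivity G k → IsConnectivity D (2 * k)
  IsConnectivity-Double {k} ((X , X-sep , ∣X∣≡k) , κ≤) =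
    (X ++ X , Separating-++ X-sep , ∣X++X∣≡2k) ,
    λ Y → subst (λ Z → Separating D Z → 2 * k ≤ ∣ Z ∣) (take++drop≡id n Y)
                (2k≤ (take n Y) (drop n Y))
    where
    ∣X++X∣≡2k : ∣ X ++ X ∣ ≡ 2 * k
    ∣X++X∣≡2k = trans (∣p++q∣≡∣p∣+∣q∣ X X) (trans (sym (2*m≡m+m ∣ X ∣)) (cong (2 *_) ∣X∣≡k))
    2k≤ : ∀ Y₀ Y₁ → Separating D (Y₀ ++ Y₁) → 2 * k ≤ ∣ Y₀ ++ Y₁ ∣
    2k≤ Y₀ Y₁ Y-sep = begin
      2 * k               ≤⟨ *-monoʳ-≤ 2 (κ≤ (Y₀ ∩ Y₁) (Separating-∩ Y-sep)) ⟩
      2 * ∣ Y₀ ∩ Y₁ ∣     ≤⟨ 2∣p∩q∣≤∣p∣+∣q∣ Y₀ Y₁ ⟩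
      ∣ Y₀ ∣ + ∣ Y₁ ∣     ≡⟨ ∣p++q∣≡∣p∣+∣q∣ Y₀ Y₁ ⟨
      ∣ Y₀ ++ Y₁ ∣        ∎
      where open ≤-Reasoning

proposition2p1 : (m : ℕ) (G : Graph (suc m)) (t t₀ : ℕ) →
    edgeCount G ≡ t * suc m + t₀ → t₀ < suc m →
    MaxConn G →
    (4 * t₀ < suc m ⊎ (suc m ≤ 2 * t₀ × 4 * t₀ < 3 * suc m)) →
    MaxConn (Double G)
proposition2p1 m G t t₀ q≡tp+t₀ t₀<p κ≡⌊2q/p⌋ regime =
  subst (IsConnectivity (Double G)) (sym κ-formula) (IsConnectivity-Double G κ≡⌊2q/p⌋)
  where
  p : ℕ
  p = suc m
  κ-formula : 2 * edgeCount (Double G) / (p + p) ≡ 2 * (2 * edgeCount G / p)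
  κ-formula = begin
    2 * edgeCount (Double G) / (p + p)     ≡⟨ /-congˡ (handshake-Double G) ⟩
    2 * (2 * (2 * edgeCount G)) / (p + p)  ≡⟨ 2*[2*m]/[n+n]≡2*[m/n] (2 * edgeCount G) m small ⟩
    2 * (2 * edgeCount G / p)              ∎
    where
    open ≡-Reasoning
    small : 2 * edgeCount G % p + 2 * edgeCount G % p < p
    small = subst (λ q → 2 * q % p + 2 * q % p < p) (sym q≡tp+t₀)
                  (remainder-below-half p t t₀ t₀<p regime)
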